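{- Let $k\ge2$ and let $(n_1,\dots,n_k)$ be an $(n,k)$-admissible sequence. Then there exists an ordered binary tree $T$ with $n$ leaves such that $n_T(i)=n_i$ for all $i\in\{1,\dots,k\}$.
   Context: In an ordered binary tree (every internal vertex has an ordered pair of children, left and right), the right depth of a leaf is the number of right steps on the path from the root to that leaf. For $i\in\{1,\dots,k\}$, $n_T(i)$ is the number of leaves of $T$ whose right depth is congruent to $i$ modulo $k$. A sequence $(n_1,\dots,n_k)$ of nonnegative integers is $(n,k)$-admissible if (i) $n_1\ge1$, $n_k\ge1$ and $n_1+\dots+n_k=n\ge2$; (ii) if $n_i=0$ for some $i\in\{2,3,\dots,k-2\}$ then $n_{i+1}=0$; (iii) if $n_{k-1}=0$ then $n_k=1$. -}

module Defs where

open import Data.Nat using (ℕ; zero; suc; _+_; _≤_; _<_; _%_; NonZero)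
open import Data.Nat.Properties using (_≟_)
open import Data.Fin using (Fin; toℕ)
import Data.Fin
open import Data.List using (List; []; _∷_; _++_; map; length; filter)
open import Data.Product using (_×_)
open import Relation.Binary.PropositionalEquality using (_≡_)

data Tree : Set where
  leaf : Tree
  node : Tree → Tree → Tree

leaves : Tree → ℕ
leaves leaf       = 1
leaves (node l r) = leaves l + leaves r

rightDepths : Tree → List ℕ
rightDepths leaf       = 0 ∷ []
rightDepths (node l r) = rightDepths l ++ map suc (rightDepths r)

-- n_T(i): number of leaves whose right depth is congruent to i modulo k
-- (only used with k ≥ 2; for k = 0 congruence mod 0 is equality)
nT : (k : ℕ) → Tree → ℕ → ℕ
nT zero    T i = length (filter (λ d → d ≟ i) (rightDepths T))
nT (suc m) T i = length (filter (λ d → (d % suc m) ≟ (i % suc m)) (rightDepths T))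

sumF : (k : ℕ) → (Fin k → ℕ) → ℕ
sumF zero    s = 0
sumF (suc k) s = s Data.Fin.zero + sumF k (λ j → s (Data.Fin.suc j))

-- A sequence (n_1,…,n_k) is stored as s : Fin k → ℕ, with n_i = s j where toℕ j + 1 = i.
-- (n,k)-admissibility, with 1-based indices i:
Admissible : (n k : ℕ) → (Fin k → ℕ) → Set
Admissible n k s =
    (∀ (j : Fin k) → toℕ j ≡ 0 → 1 ≤ s j)
  × (∀ (j : Fin k) → suc (toℕ j) ≡ k → 1 ≤ s j)
  × (sumF k s ≡ n) × (2 ≤ n)
  × (∀ (j j' : Fin k) → 2 ≤ suc (toℕ j) → suc (toℕ j) + 2 ≤ k
        → toℕ j' ≡ suc (toℕ j) → s j ≡ 0 → s j' ≡ 0)         -- n_i = 0, 2 ≤ i ≤ k-2 ⇒ n_{i+1} = 0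
  × (∀ (j j' : Fin k) → suc (toℕ j) + 1 ≡ k → suc (toℕ j') ≡ k
        → s j ≡ 0 → s j' ≡ 1)                                -- n_{k-1} = 0 ⇒ n_k = 1

{-# OPTIONS --safe #-}
module Submission where

-- The tree is a chain of k left combs, each hanging from the right child of the lowest vertex
-- of the previous one, so that it has one leaf at right depth 0 and u_d leaves at right depth d
-- for 1 ≤ d ≤ k, where u = (n_1, …, n_{k-1}, n_k − 1).  Right depths 0 and k share the residue
-- k, so the residue counts are exactly n_1, …, n_k.  Such a tree exists whenever u has no gap
-- (u_d = 0 forces u_{d+1} = 0), and admissibility says precisely that: n_1 ≥ 1, condition (ii)
-- propagates zeros through the middle, and (iii) gives u_k = 0 when u_{k-1} = 0.

open import Defs
open import Data.Nat using (ℕ; zero; suc; _+_; _*_; _∸_; _≤_; _%_; NonZero; z≤n; s≤s)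
open import Data.Nat.Properties
open import Data.Nat.DivMod using (n%n≡0; m<n⇒m%n≡m; %-congˡ)
open import Data.Nat.ListAction using (sum)
open import Data.Nat.ListAction.Properties using (sum-++)
open import Data.Nat.Tactic.RingSolver using (solve-∀)
open import Algebra.Properties.CommutativeSemigroup +-commutativeSemigroup
  using () renaming (interchange to +-interchange)
open import Data.Fin as Fin using (Fin; toℕ; fromℕ)
open import Data.Fin.Properties using (toℕ-fromℕ; toℕ<n; toℕ-injective)
  renaming (suc-injective to Fin-suc-injective)
open import Data.List using ([]; _∷_; _++_; map; length; filter)
open import Data.List.Properties using (map-++; map-∘)
open import Data.Product using (Σ; _×_; _,_)
open import Data.Sum using (inj₁; inj₂)
open import Function using (_∘_)
open import Relation.Nullary using (Dec; yes; no; ¬_; contradiction)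
open import Relation.Unary using (Pred; Decidable)
open import Relation.Binary.PropositionalEquality

sumF-cong : ∀ k {f g : Fin k → ℕ} → (∀ j → f j ≡ g j) → sumF k f ≡ sumF k g
sumF-cong zero    f≗g = refl
sumF-cong (suc k) f≗g = cong₂ _+_ (f≗g Fin.zero) (sumF-cong k (f≗g ∘ Fin.suc))

sumF-zero : ∀ k {f : Fin k → ℕ} → (∀ j → f j ≡ 0) → sumF k f ≡ 0
sumF-zero zero    f≡0 = refl
sumF-zero (suc k) f≡0 = cong₂ _+_ (f≡0 Fin.zero) (sumF-zero k (f≡0 ∘ Fin.suc))

sumF-single : ∀ k {f : Fin k → ℕ} i → (∀ j → j ≢ i → f j ≡ 0) → sumF k f ≡ f i
sumF-single (suc k) {f} Fin.zero f≡0 =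
  trans (cong (f Fin.zero +_) (sumF-zero k λ j → f≡0 (Fin.suc j) λ ())) (+-identityʳ _)
sumF-single (suc k) (Fin.suc i) f≡0 =
  cong₂ _+_ (f≡0 Fin.zero λ ())
            (sumF-single k i λ j j≢i → f≡0 (Fin.suc j) (j≢i ∘ Fin-suc-injective))

sumF-+ : ∀ k (f g : Fin k → ℕ) → sumF k (λ j → f j + g j) ≡ sumF k f + sumF k g
sumF-+ zero    f g = refl
sumF-+ (suc k) f g = begin
  (f Fin.zero + g Fin.zero) + sumF k (λ j → f (Fin.suc j) + g (Fin.suc j))
    ≡⟨ cong (f Fin.zero + g Fin.zero +_) (sumF-+ k (f ∘ Fin.suc) (g ∘ Fin.suc)) ⟩
  (f Fin.zero + g Fin.zero) + (sumF k (f ∘ Fin.suc) + sumF k (g ∘ Fin.suc))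
    ≡⟨ +-interchange (f Fin.zero) (g Fin.zero) _ _ ⟩
  (f Fin.zero + sumF k (f ∘ Fin.suc)) + (g Fin.zero + sumF k (g ∘ Fin.suc)) ∎
  where open ≡-Reasoning

𝟙 : ∀ {a} {A : Set a} → Dec A → ℕ
𝟙 (yes _) = 1
𝟙 (no _)  = 0

𝟙-yes : ∀ {a} {A : Set a} (a? : Dec A) → A → 𝟙 a? ≡ 1
𝟙-yes (yes _) _ = refl
𝟙-yes (no ¬a) a = contradiction a ¬a

𝟙-no : ∀ {a} {A : Set a} (a? : Dec A) → ¬ A → 𝟙 a? ≡ 0
𝟙-no (yes a) ¬a = contradiction a ¬a
𝟙-no (no _)  _  = refl

𝟙-cong : ∀ {a b} {A : Set a} {B : Set b} (a? : Dec A) (b? : Dec B) →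
         (A → B) → (B → A) → 𝟙 a? ≡ 𝟙 b?
𝟙-cong a? b? A→B B→A with b?
... | yes b = 𝟙-yes a? (B→A b)
... | no ¬b = 𝟙-no a? (¬b ∘ A→B)

length-filter : ∀ {a p} {A : Set a} {P : Pred A p} (P? : Decidable P) xs →
                length (filter P? xs) ≡ sum (map (𝟙 ∘ P?) xs)
length-filter P? []       = refl
length-filter P? (x ∷ xs) with P? x
... | yes _ = cong suc (length-filter P? xs)
... | no _  = length-filter P? xs

weight : (ℕ → ℕ) → Tree → ℕ
weight w T = sum (map w (rightDepths T))

weight-node : ∀ w l r → weight w (node l r) ≡ weight w l + weight (w ∘ suc) r
weight-node w l r = begin
  sum (map w (rightDepths l ++ map suc (rightDepths r)))
    ≡⟨ cong sum (map-++ w (rightDepths l) _) ⟩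
  sum (map w (rightDepths l) ++ map w (map suc (rightDepths r)))
    ≡⟨ sum-++ (map w (rightDepths l)) _ ⟩
  weight w l + sum (map w (map suc (rightDepths r)))
    ≡⟨ cong (λ ds → weight w l + sum ds) (map-∘ (rightDepths r)) ⟨
  weight w l + weight (w ∘ suc) r ∎
  where open ≡-Reasoning

leaves≡weight : ∀ T → leaves T ≡ weight (λ _ → 1) T
leaves≡weight leaf       = refl
leaves≡weight (node l r) =
  trans (cong₂ _+_ (leaves≡weight l) (leaves≡weight r)) (sym (weight-node _ l r))

comb : ℕ → Tree → Tree
comb zero    t = node leaf t
comb (suc c) t = node (comb c t) leaf

weight-comb : ∀ w c t → weight w (comb c t) ≡ w 0 + c * w 1 + weight (w ∘ suc) t
weight-comb w zero    t = weight-node w leaf t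
weight-comb w (suc c) t = begin
  weight w (comb (suc c) t)                          ≡⟨ weight-node w (comb c t) leaf ⟩
  weight w (comb c t) + (w 1 + 0)                    ≡⟨ cong (_+ (w 1 + 0)) (weight-comb w c t) ⟩
  w 0 + c * w 1 + weight (w ∘ suc) t + (w 1 + 0)     ≡⟨ shuffle (w 0) (w 1) (c * w 1) _ ⟩
  w 0 + (w 1 + c * w 1) + weight (w ∘ suc) t         ∎
  where
  open ≡-Reasoning
  shuffle : ∀ a b x y → a + x + y + (b + 0) ≡ a + (b + x) + y
  shuffle = solve-∀

caterpillar : (L : ℕ) → (Fin L → ℕ) → Tree
caterpillar zero    u = leaf
caterpillar (suc L) u with u Fin.zero
... | zero  = leaf
... | suc c = comb c (caterpillar L (u ∘ Fin.suc))

Gapless : (L : ℕ) → (Fin L → ℕ) → Set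
Gapless L u = ∀ (i j : Fin L) → toℕ j ≡ suc (toℕ i) → u i ≡ 0 → u j ≡ 0

gapless-tail : ∀ {L u} → Gapless (suc L) u → Gapless L (u ∘ Fin.suc)
gapless-tail gapless i j j≡1+i = gapless (Fin.suc i) (Fin.suc j) (cong suc j≡1+i)

gapless-head≡0 : ∀ {L u} → Gapless (suc L) u → u Fin.zero ≡ 0 → ∀ j → u j ≡ 0
gapless-head≡0               gapless u₀≡0 Fin.zero    = u₀≡0
gapless-head≡0 {L = suc L} gapless u₀≡0 (Fin.suc j) =
  gapless-head≡0 (gapless-tail gapless) (gapless Fin.zero (Fin.suc Fin.zero) refl u₀≡0) j

weight-caterpillar : ∀ L u → Gapless L u → ∀ w →
                     weight w (caterpillar L u) ≡ w 0 + sumF L (λ j → u j * w (suc (toℕ j)))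
weight-caterpillar zero    u gapless w = refl
weight-caterpillar (suc L) u gapless w with u Fin.zero in u₀
... | zero  = sym (cong (w 0 +_) (sumF-zero L λ j →
                cong (_* w (2 + toℕ j)) (gapless-head≡0 gapless u₀ (Fin.suc j))))
... | suc c = begin
  weight w (comb c tail)                         ≡⟨ weight-comb w c tail ⟩
  w 0 + c * w 1 + weight (w ∘ suc) tail
    ≡⟨ cong (w 0 + c * w 1 +_) (weight-caterpillar L _ (gapless-tail gapless) (w ∘ suc)) ⟩
  w 0 + c * w 1 + (w 1 + rest)                   ≡⟨ shuffle (w 0) (w 1) (c * w 1) rest ⟩
  w 0 + (w 1 + c * w 1 + rest)                   ∎
  where
  open ≡-Reasoning
  tail : Tree
  tail = caterpillar L (u ∘ Fin.suc)
  rest : ℕ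
  rest = sumF L (λ j → u (Fin.suc j) * w (2 + toℕ j))
  shuffle : ∀ a b x y → a + x + (b + y) ≡ a + (b + x + y)
  shuffle = solve-∀

leaves-caterpillar : ∀ L u → Gapless L u → leaves (caterpillar L u) ≡ suc (sumF L u)
leaves-caterpillar L u gapless =
  trans (leaves≡weight (caterpillar L u))
        (trans (weight-caterpillar L u gapless _)
               (cong suc (sumF-cong L λ j → *-identityʳ (u j))))

module _ {K : ℕ} .{{_ : NonZero K}} where

  suc-%≡0⇒≡ : ∀ {a} → suc a ≤ K → suc a % K ≡ 0 → suc a ≡ K
  suc-%≡0⇒≡ 1+a≤K %≡0 with m≤n⇒m<n∨m≡n 1+a≤K
  ... | inj₁ 1+a<K = contradiction (trans (sym (m<n⇒m%n≡m 1+a<K)) %≡0) λ ()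
  ... | inj₂ 1+a≡K = 1+a≡K

  ≡⇒%≡0 : ∀ {a} → a ≡ K → a % K ≡ 0
  ≡⇒%≡0 a≡K = trans (%-congˡ a≡K) (n%n≡0 K)

  suc-%-injective : ∀ {a b} → suc a ≤ K → suc b ≤ K → suc a % K ≡ suc b % K → a ≡ b
  suc-%-injective 1+a≤K 1+b≤K %≡% with m≤n⇒m<n∨m≡n 1+a≤K | m≤n⇒m<n∨m≡n 1+b≤K
  ... | inj₁ 1+a<K | inj₁ 1+b<K =
    suc-injective (trans (sym (m<n⇒m%n≡m 1+a<K)) (trans %≡% (m<n⇒m%n≡m 1+b<K)))
  ... | inj₁ 1+a<K | inj₂ 1+b≡K =
    contradiction (suc-%≡0⇒≡ 1+a≤K (trans %≡% (≡⇒%≡0 1+b≡K))) (<⇒≢ 1+a<K)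
  ... | inj₂ 1+a≡K | _ =
    suc-injective (trans 1+a≡K (sym (suc-%≡0⇒≡ 1+b≤K (trans (sym %≡%) (≡⇒%≡0 1+a≡K)))))

isLast? : ∀ {K} (j : Fin K) → Dec (suc (toℕ j) ≡ K)
isLast? {K} j = suc (toℕ j) ≟ K

sumF-𝟙-isLast : ∀ k → sumF (suc k) (𝟙 ∘ isLast?) ≡ 1
sumF-𝟙-isLast k =
  trans (sumF-single (suc k) (fromℕ k) off-last) (𝟙-yes (isLast? (fromℕ k)) (cong suc (toℕ-fromℕ k)))
  where
  off-last : ∀ j → j ≢ fromℕ k → 𝟙 (isLast? j) ≡ 0
  off-last j j≢last = 𝟙-no (isLast? j) λ last →
    j≢last (toℕ-injective (trans (suc-injective last) (sym (toℕ-fromℕ k))))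

nT-caterpillar : ∀ k u → Gapless (suc k) u → ∀ i →
                 nT (suc k) (caterpillar (suc k) u) (suc (toℕ i)) ≡ u i + 𝟙 (isLast? i)
nT-caterpillar k u gapless i = begin
  nT K T (suc (toℕ i))
    ≡⟨ length-filter (λ d → d % K ≟ suc (toℕ i) % K) (rightDepths T) ⟩
  weight residue T
    ≡⟨ weight-caterpillar K u gapless residue ⟩
  residue 0 + sumF K (λ j → u j * residue (suc (toℕ j)))
    ≡⟨ cong₂ _+_ residue0 (sumF-single K i off-i) ⟩
  𝟙 (isLast? i) + u i * residue (suc (toℕ i))
    ≡⟨ cong (λ x → 𝟙 (isLast? i) + u i * x) (𝟙-yes (suc (toℕ i) % K ≟ suc (toℕ i) % K) refl) ⟩
  𝟙 (isLast? i) + u i * 1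
    ≡⟨ cong (𝟙 (isLast? i) +_) (*-identityʳ (u i)) ⟩
  𝟙 (isLast? i) + u i
    ≡⟨ +-comm (𝟙 (isLast? i)) (u i) ⟩
  u i + 𝟙 (isLast? i) ∎
  where
  open ≡-Reasoning
  K : ℕ
  K = suc k
  T : Tree
  T = caterpillar K u
  residue : ℕ → ℕ
  residue d = 𝟙 (d % K ≟ suc (toℕ i) % K)
  residue0 : residue 0 ≡ 𝟙 (isLast? i)
  residue0 = 𝟙-cong (0 ≟ suc (toℕ i) % K) (isLast? i)
    (λ 0≡ → suc-%≡0⇒≡ (toℕ<n i) (sym 0≡)) (λ last → sym (≡⇒%≡0 last))
  off-i : ∀ j → j ≢ i → u j * residue (suc (toℕ j)) ≡ 0
  off-i j j≢i = trans (cong (u j *_) (𝟙-no (suc (toℕ j) % K ≟ suc (toℕ i) % K)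
                        λ %≡% → j≢i (toℕ-injective (suc-%-injective (toℕ<n j) (toℕ<n i) %≡%))))
                      (*-zeroʳ (u j))

lower : ∀ {K} → (Fin K → ℕ) → Fin K → ℕ
lower s j = s j ∸ 𝟙 (isLast? j)

lower+𝟙 : ∀ {n K s} → Admissible n K s → ∀ j → lower s j + 𝟙 (isLast? j) ≡ s j
lower+𝟙 {s = s} (_ , n_K≥1 , _) j = m∸n+n≡m 𝟙≤s
  where
  𝟙≤s : 𝟙 (isLast? j) ≤ s j
  𝟙≤s with isLast? j
  ... | yes last = n_K≥1 j last
  ... | no _     = z≤n

suc-sumF-lower : ∀ {n k s} → Admissible n (suc k) s → suc (sumF (suc k) (lower s)) ≡ n
suc-sumF-lower {n} {k} {s} adm@(_ , _ , sum≡n , _) = begin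
  suc (sumF K (lower s))                              ≡⟨ +-comm 1 _ ⟩
  sumF K (lower s) + 1                                ≡⟨ cong (sumF K (lower s) +_) (sumF-𝟙-isLast k) ⟨
  sumF K (lower s) + sumF K (𝟙 ∘ isLast?)             ≡⟨ sumF-+ K (lower s) (𝟙 ∘ isLast?) ⟨
  sumF K (λ j → lower s j + 𝟙 (isLast? j))            ≡⟨ sumF-cong K (lower+𝟙 adm) ⟩
  sumF K s                                            ≡⟨ sum≡n ⟩
  n                                                   ∎
  where
  open ≡-Reasoning
  K : ℕ
  K = suc k

lower-gapless : ∀ {n K s} → Admissible n K s → Gapless K (lower s)
lower-gapless {K = K} {s} (n₁≥1 , _ , _ , _ , no-gap , n_K≡1) i j j≡1+i lowerᵢ≡0 =
  lower-next (isLast? j)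
  where
  sᵢ≡0 : s i ≡ 0
  sᵢ≡0 = trans (cong (s i ∸_) (sym (𝟙-no (isLast? i) i-not-last))) lowerᵢ≡0
    where
    i-not-last : suc (toℕ i) ≢ K
    i-not-last last = <⇒≢ (toℕ<n j) (trans j≡1+i last)

  lower-next : (last? : Dec (suc (toℕ j) ≡ K)) → s j ∸ 𝟙 last? ≡ 0
  lower-next (yes last) = cong (_∸ 1) (n_K≡1 i j 2+i≡K last sᵢ≡0)
    where
    2+i≡K : suc (toℕ i) + 1 ≡ K
    2+i≡K = trans (+-comm (suc (toℕ i)) 1) (trans (cong suc (sym j≡1+i)) last)
  lower-next (no not-last) = no-gap i j (s≤s (n≢0⇒n>0 i≢0)) 3+i≤K j≡1+i sᵢ≡0
    where
    i≢0 : toℕ i ≢ 0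
    i≢0 i≡0 = contradiction (subst (1 ≤_) sᵢ≡0 (n₁≥1 i i≡0)) λ ()
    3+i≤K : suc (toℕ i) + 2 ≤ K
    3+i≤K = subst (_≤ K) (trans (cong (suc ∘ suc) j≡1+i) (+-comm 2 (suc (toℕ i))))
                  (≤∧≢⇒< (toℕ<n j) not-last)

lemma7p7 : (k n : ℕ) → (hk : 2 ≤ k) → (s : Fin k → ℕ) → Admissible n k s →
    Σ Tree (λ T → (leaves T ≡ n) × (∀ (j : Fin k) → nT k T (suc (toℕ j)) ≡ s j))
lemma7p7 zero    n () s adm
lemma7p7 (suc k) n _  s adm = T , leaves≡n , nT≡s
  where
  T : Tree
  T = caterpillar (suc k) (lower s)

  gapless : Gapless (suc k) (lower s)
  gapless = lower-gapless adm

  leaves≡n : leaves T ≡ n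
  leaves≡n = trans (leaves-caterpillar (suc k) (lower s) gapless) (suc-sumF-lower adm)

  nT≡s : ∀ j → nT (suc k) T (suc (toℕ j)) ≡ s j
  nT≡s j = trans (nT-caterpillar k (lower s) gapless j) (lower+𝟙 adm j)
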